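{- Let $G=(V,E)$ be a graph, $c:V\to\mathbb{N}$, and $\epsilon>0$. Every maximal solution of the integer program IP2 is a feasible solution of PDBEP; i.e., if $E'$ is a maximal solution of IP2 then for every edge $(u,v)\in E'$ we have $d'_u\le c_u$ or $d'_v\le c_v$, where $d'_x$ is the degree of $x$ in $(V,E')$.
   Context: IP2 (for fixed $\epsilon>0$): maximize $\phi=2\sum_{e\in E}y_e-(1+\epsilon)\sum_{v\in V}z_v$ subject to $\sum_{e\in\delta(v)}y_e\le c_v+z_v$ for all $v\in V$, $z_v\in\{0,1,2,\dots\}$ for all $v$, $y_e\in\{0,1\}$ for all $e$, where $\delta(v)$ is the set of edges incident on $v$. A solution is identified with the edge set $E'=\{e: y_e=1\}$. A maximal solution of IP2 is a solution in which $z_v=\max\{0,\sum_{e\in\delta(v)}y_e-c_v\}$ for all $v$ and in which deleting an edge from $E'$ or adding an edge of $E\setminus E'$ (with the $z$-values recomputed by the same formula) does not improve the objective value.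
   Formalization: The parameter ε of IP2 ranges over the positive rationals. -}

module Defs where

open import Data.Nat using (ℕ; zero; suc; _∸_; _+_)
open import Data.Fin using (Fin; zero; suc; _≟_)
open import Data.Bool using (Bool; true; false; if_then_else_; _∧_; _∨_; not)
open import Data.Product using (_×_; _,_; proj₁; proj₂)
open import Data.Integer using (+_)
open import Data.Rational using (ℚ; _/_; _*_; _-_; _+_; 1ℚ; _≤_)
open import Relation.Nullary.Decidable using (⌊_⌋)
open import Relation.Binary.PropositionalEquality using (_≡_; _≢_)

record Graph (n m : ℕ) : Set where
  field
    ends     : Fin m → Fin n × Fin n
    noLoop   : ∀ e → proj₁ (ends e) ≢ proj₂ (ends e)
    noParallel : ∀ e f →
      ((proj₁ (ends e) ≡ proj₁ (ends f)) × (proj₂ (ends e) ≡ proj₂ (ends f))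
        → e ≡ f) ×
      ((proj₁ (ends e) ≡ proj₂ (ends f)) × (proj₂ (ends e) ≡ proj₁ (ends f))
        → e ≡ f)
open Graph public

count : ∀ {k} → (Fin k → Bool) → ℕ
count {zero}  p = 0
count {suc k} p = (if p zero then 1 else 0) Data.Nat.+ count (λ i → p (suc i))

sumF : ∀ {k} → (Fin k → ℕ) → ℕ
sumF {zero}  f = 0
sumF {suc k} f = f zero Data.Nat.+ sumF (λ i → f (suc i))

incident : ∀ {n m} → Graph n m → Fin m → Fin n → Bool
incident G e x = ⌊ proj₁ (ends G e) ≟ x ⌋ ∨ ⌊ proj₂ (ends G e) ≟ x ⌋

-- an edge subset E' ⊆ E is given by its characteristic function (y_e)
EdgeSet : ℕ → Set
EdgeSet m = Fin m → Bool

deg : ∀ {n m} → Graph n m → EdgeSet m → Fin n → ℕ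
deg G E' x = count (λ e → E' e ∧ incident G e x)

-- z_v = max{0, d'_v − c_v}
zval : ∀ {n m} → Graph n m → (Fin n → ℕ) → EdgeSet m → Fin n → ℕ
zval G c E' v = deg G E' v ∸ c v

ℕtoℚ : ℕ → ℚ
ℕtoℚ k = (+ k) / 1

phi : ∀ {n m} → Graph n m → (Fin n → ℕ) → ℚ → EdgeSet m → ℚ
phi G c ε E' =
  ℕtoℚ (2 Data.Nat.* count E') - ((1ℚ Data.Rational.+ ε) * ℕtoℚ (sumF (zval G c E')))

toggle : ∀ {m} → EdgeSet m → Fin m → EdgeSet m
toggle E' e f = if ⌊ f ≟ e ⌋ then not (E' f) else E' f

-- maximal solution of IP2: no single deletion / addition improves φ
MaximalIP2 : ∀ {n m} → Graph n m → (Fin n → ℕ) → ℚ → EdgeSet m → Set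
MaximalIP2 G c ε E' = ∀ e → phi G c ε (toggle E' e) ≤ phi G c ε E'

module Submission where

-- Suppose e = (u , v) ∈ E' while both endpoints are overfull,
-- d'_u > c_u and d'_v > c_v.  Deleting e lowers Σ y by one, costing 2 in
-- the objective, but it also lowers both z_u and z_v by one (they are
-- positive), gaining 2(1 + ε).  So deletion raises φ by 2ε > 0,
-- contradicting maximality.

open import Defs
open import Data.Nat using (ℕ)
open import Data.Fin using (Fin)
open import Data.Bool using (true)
open import Data.Product using (proj₁; proj₂)
open import Data.Sum using (_⊎_)
open import Data.Rational using (ℚ; 0ℚ; _<_)
open import Relation.Binary.PropositionalEquality using (_≡_)

open import Data.Nat as ℕ using (suc; _∸_; _≤?_)
import Data.Nat.Properties as ℕP
open import Data.Fin using (zero; suc; _≟_)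
open import Data.Fin.Properties using (suc-injective)
open import Data.Bool using (Bool; false; if_then_else_; _∧_; not)
open import Data.Bool.Properties using (∨-zeroʳ; ∧-zeroʳ)
open import Data.Product using (_,_)
open import Data.Sum using (inj₁; inj₂)
open import Data.Empty using (⊥-elim)
open import Data.Integer as ℤ using (+_)
import Data.Integer.Properties as ℤP
open import Data.Rational as ℚ using (mkℚ; 1ℚ; _+_; _*_; _-_)
import Data.Rational.Properties as ℚP
open import Data.Rational.Solver using (module +-*-Solver)
open import Data.Nat.Divisibility using (∣1⇒≡1)
open import Relation.Nullary using (yes; no; ¬_)
open import Relation.Nullary.Decidable using (⌊_⌋)
open import Relation.Binary.PropositionalEquality
  using (refl; sym; trans; subst; cong; cong₂; _≢_; module ≡-Reasoning)

sumF-ext : ∀ {k} (f g : Fin k → ℕ) → (∀ j → f j ≡ g j) → sumF f ≡ sumF g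
sumF-ext {ℕ.zero} f g f≗g = refl
sumF-ext {suc k}  f g f≗g =
  cong₂ ℕ._+_ (f≗g zero) (sumF-ext _ _ (λ j → f≗g (suc j)))

sumF-step : ∀ {k} (f g : Fin k → ℕ) (i : Fin k) → f i ≡ suc (g i) →
  (∀ j → j ≢ i → f j ≡ g j) → sumF f ≡ suc (sumF g)
sumF-step f g zero fi f≗g rewrite fi =
  cong (λ s → suc (g zero ℕ.+ s)) (sumF-ext _ _ (λ j → f≗g (suc j) (λ ())))
sumF-step f g (suc i) fi f≗g rewrite f≗g zero (λ ()) =
  trans (cong (g zero ℕ.+_) (sumF-step _ _ i fi tail-agree)) (ℕP.+-suc (g zero) _)
  where
  tail-agree : ∀ j → j ≢ i → f (suc j) ≡ g (suc j)
  tail-agree j j≢i = f≗g (suc j) (λ eq → j≢i (suc-injective eq))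

sumF-step₂ : ∀ {k} (f g : Fin k → ℕ) (i j : Fin k) → i ≢ j →
  f i ≡ suc (g i) → f j ≡ suc (g j) →
  (∀ l → l ≢ i → l ≢ j → f l ≡ g l) → sumF f ≡ 2 ℕ.+ sumF g
sumF-step₂ f g i j i≢j fi fj f≗g =
  trans (sumF-step f h i h-at-i f≗h) (cong suc (sumF-step h g j h-at-j h≗g))
  where
  h : Fin _ → ℕ
  h l = if ⌊ l ≟ i ⌋ then g l else f l

  h-at-i : f i ≡ suc (h i)
  h-at-i with i ≟ i
  ... | yes _   = fi
  ... | no i≢i  = ⊥-elim (i≢i refl)

  f≗h : ∀ l → l ≢ i → f l ≡ h l
  f≗h l l≢i with l ≟ i
  ... | yes l≡i = ⊥-elim (l≢i l≡i)
  ... | no _    = refl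

  h-at-j : h j ≡ suc (g j)
  h-at-j with j ≟ i
  ... | yes j≡i = ⊥-elim (i≢j (sym j≡i))
  ... | no _    = fj

  h≗g : ∀ l → l ≢ j → h l ≡ g l
  h≗g l l≢j with l ≟ i
  ... | yes _   = refl
  ... | no l≢i  = f≗g l l≢i l≢j

indicator : Bool → ℕ
indicator b = if b then 1 else 0

count-as-sumF : ∀ {k} (p : Fin k → Bool) → count p ≡ sumF (λ i → indicator (p i))
count-as-sumF {ℕ.zero} p = refl
count-as-sumF {suc k}  p = cong (indicator (p zero) ℕ.+_) (count-as-sumF (λ i → p (suc i)))

count-ext : ∀ {k} (p q : Fin k → Bool) → (∀ j → p j ≡ q j) → count p ≡ count q
count-ext p q p≗q = begin
  count p                          ≡⟨ count-as-sumF p ⟩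
  sumF (λ i → indicator (p i))     ≡⟨ sumF-ext _ _ (λ j → cong indicator (p≗q j)) ⟩
  sumF (λ i → indicator (q i))     ≡⟨ sym (count-as-sumF q) ⟩
  count q                          ∎
  where open ≡-Reasoning

count-step : ∀ {k} (p q : Fin k → Bool) (i : Fin k) → p i ≡ true → q i ≡ false →
  (∀ j → j ≢ i → p j ≡ q j) → count p ≡ suc (count q)
count-step p q i pi qi p≗q = begin
  count p                            ≡⟨ count-as-sumF p ⟩
  sumF (λ l → indicator (p l))       ≡⟨ sumF-step _ _ i drop (λ j j≢i → cong indicator (p≗q j j≢i)) ⟩
  suc (sumF (λ l → indicator (q l))) ≡⟨ cong suc (sym (count-as-sumF q)) ⟩
  suc (count q)                      ∎
  where
  open ≡-Reasoning
  drop : indicator (p i) ≡ suc (indicator (q i))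
  drop rewrite pi | qi = refl

toggle-here : ∀ {m} (E' : EdgeSet m) e → toggle E' e e ≡ not (E' e)
toggle-here E' e with e ≟ e
... | yes _   = refl
... | no e≢e  = ⊥-elim (e≢e refl)

toggle-elsewhere : ∀ {m} (E' : EdgeSet m) e f → f ≢ e → toggle E' e f ≡ E' f
toggle-elsewhere E' e f f≢e with f ≟ e
... | yes f≡e = ⊥-elim (f≢e f≡e)
... | no _    = refl

incident-proj₁ : ∀ {n m} (G : Graph n m) e → incident G e (proj₁ (ends G e)) ≡ true
incident-proj₁ G e with proj₁ (ends G e) ≟ proj₁ (ends G e)
... | yes _   = refl
... | no u≢u  = ⊥-elim (u≢u refl)

incident-proj₂ : ∀ {n m} (G : Graph n m) e → incident G e (proj₂ (ends G e)) ≡ true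
incident-proj₂ G e with proj₂ (ends G e) ≟ proj₂ (ends G e)
... | yes _   = ∨-zeroʳ _
... | no v≢v  = ⊥-elim (v≢v refl)

incident-other : ∀ {n m} (G : Graph n m) e x →
  x ≢ proj₁ (ends G e) → x ≢ proj₂ (ends G e) → incident G e x ≡ false
incident-other G e x x≢u x≢v with proj₁ (ends G e) ≟ x | proj₂ (ends G e) ≟ x
... | yes u≡x | _       = ⊥-elim (x≢u (sym u≡x))
... | no _    | yes v≡x = ⊥-elim (x≢v (sym v≡x))
... | no _    | no _    = refl

excess-step : ∀ {d d′ c} → d ≡ suc d′ → ¬ (d ℕ.≤ c) → d ∸ c ≡ suc (d′ ∸ c)
excess-step refl d≰c =
  ℕP.+-∸-assoc 1 (ℕP.≤-pred (ℕP.≰⇒> d≰c))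

module Deletion {n m} (G : Graph n m) (c : Fin n → ℕ)
                (E' : EdgeSet m) (e : Fin m) (e∈E' : E' e ≡ true) where

  E'' : EdgeSet m
  E'' = toggle E' e

  e∉E'' : E'' e ≡ false
  e∉E'' = trans (toggle-here E' e) (cong not e∈E')

  count-drops : count E' ≡ suc (count E'')
  count-drops =
    count-step E' E'' e e∈E' e∉E'' (λ f f≢e → sym (toggle-elsewhere E' e f f≢e))

  deg-drops : ∀ x → incident G e x ≡ true → deg G E' x ≡ suc (deg G E'' x)
  deg-drops x e~x = count-step _ _ e (cong₂ _∧_ e∈E' e~x) (cong (_∧ incident G e x) e∉E'')
    (λ f f≢e → cong (_∧ incident G f x) (sym (toggle-elsewhere E' e f f≢e)))

  deg-same : ∀ x → incident G e x ≡ false → deg G E' x ≡ deg G E'' x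
  deg-same x e≁x = count-ext _ _ agree
    where
    agree : ∀ f → (E' f ∧ incident G f x) ≡ (E'' f ∧ incident G f x)
    agree f with f ≟ e
    ... | yes refl rewrite e≁x = trans (∧-zeroʳ (E' f)) (sym (∧-zeroʳ (not (E' f))))
    ... | no _     = refl

  zval-drops : ∀ x → incident G e x ≡ true → ¬ (deg G E' x ℕ.≤ c x) →
    zval G c E' x ≡ suc (zval G c E'' x)
  zval-drops x e~x = excess-step (deg-drops x e~x)

  sum-zval-drops : ¬ (deg G E' (proj₁ (ends G e)) ℕ.≤ c (proj₁ (ends G e))) →
                   ¬ (deg G E' (proj₂ (ends G e)) ℕ.≤ c (proj₂ (ends G e))) →
    sumF (zval G c E') ≡ 2 ℕ.+ sumF (zval G c E'')
  sum-zval-drops u-over v-over =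
    sumF-step₂ _ _ _ _ (noLoop G e)
      (zval-drops _ (incident-proj₁ G e) u-over)
      (zval-drops _ (incident-proj₂ G e) v-over)
      (λ x x≢u x≢v → cong (_∸ c x) (deg-same x (incident-other G e x x≢u x≢v)))

ℕtoℚ≡mkℚ : ∀ k → ℕtoℚ k ≡ mkℚ (+ k) 0 (λ (_ , d∣1) → ∣1⇒≡1 d∣1)
ℕtoℚ≡mkℚ k = ℚP.↥p/↧p≡p _

ℕtoℚ-+ : ∀ a b → ℕtoℚ (a ℕ.+ b) ≡ ℕtoℚ a + ℕtoℚ b
ℕtoℚ-+ a b rewrite ℕtoℚ≡mkℚ a | ℕtoℚ≡mkℚ b =
  cong (ℚ._/ 1) (sym (cong₂ ℤ._+_ (ℤP.*-identityʳ (+ a)) (ℤP.*-identityʳ (+ b))))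

objective-shift : ∀ ε a s →
  ℕtoℚ (2 ℕ.+ a) - (1ℚ + ε) * ℕtoℚ (2 ℕ.+ s)
    ≡ (ℕtoℚ a - (1ℚ + ε) * ℕtoℚ s) - (ε + ε)
objective-shift ε a s
  rewrite ℕtoℚ-+ 2 a | ℕtoℚ-+ 2 s | ℕtoℚ-+ 1 1 = shift ε (ℕtoℚ a) (ℕtoℚ s)
  where
  open +-*-Solver
  shift : ∀ ε A S → ((1ℚ + 1ℚ) + A) - (1ℚ + ε) * ((1ℚ + 1ℚ) + S)
                      ≡ (A - (1ℚ + ε) * S) - (ε + ε)
  shift = solve 3 (λ ε A S →
    ((con 1ℚ :+ con 1ℚ) :+ A) :- (con 1ℚ :+ ε) :* ((con 1ℚ :+ con 1ℚ) :+ S)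
      := (A :- (con 1ℚ :+ ε) :* S) :- (ε :+ ε)) refl

no-descent : ∀ ε X → 0ℚ < ε → ¬ (X ℚ.≤ X - (ε + ε))
no-descent ε X ε>0 X≤X-2ε = ℚP.<-irrefl refl (ℚP.≤-<-trans X≤X-2ε X-2ε<X)
  where
  X-2ε<X : X - (ε + ε) < X
  X-2ε<X = ℚP.<-respʳ-≡ (ℚP.+-identityʳ X)
    (ℚP.+-monoʳ-< X (ℚP.neg-antimono-< (ℚP.+-mono-< ε>0 ε>0)))

phi-after-deletion : ∀ {n m} (G : Graph n m) c ε (E' : EdgeSet m) e (e∈E' : E' e ≡ true) →
  ¬ (deg G E' (proj₁ (ends G e)) ℕ.≤ c (proj₁ (ends G e))) →
  ¬ (deg G E' (proj₂ (ends G e)) ℕ.≤ c (proj₂ (ends G e))) →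
  phi G c ε E' ≡ phi G c ε (toggle E' e) - (ε + ε)
phi-after-deletion G c ε E' e e∈E' u-over v-over = begin
  ℕtoℚ (2 ℕ.* count E') - (1ℚ + ε) * ℕtoℚ (sumF (zval G c E'))
    ≡⟨ cong₂ (λ a s → ℕtoℚ a - (1ℚ + ε) * ℕtoℚ s) twice-count (sum-zval-drops u-over v-over) ⟩
  ℕtoℚ (2 ℕ.+ 2 ℕ.* count E'') - (1ℚ + ε) * ℕtoℚ (2 ℕ.+ sumF (zval G c E''))
    ≡⟨ objective-shift ε (2 ℕ.* count E'') (sumF (zval G c E'')) ⟩
  phi G c ε E'' - (ε + ε) ∎
  where
  open ≡-Reasoning
  open Deletion G c E' e e∈E'
  twice-count : 2 ℕ.* count E' ≡ 2 ℕ.+ 2 ℕ.* count E''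
  twice-count = trans (cong (2 ℕ.*_) count-drops) (ℕP.*-suc 2 (count E''))

lemma4 : ∀ {n m} (G : Graph n m) (c : Fin n → ℕ) (ε : ℚ) → 0ℚ < ε →
    (E' : EdgeSet m) → MaximalIP2 G c ε E' →
    ∀ e → E' e ≡ true →
    (Data.Nat._≤_ (deg G E' (proj₁ (ends G e))) (c (proj₁ (ends G e))))
    ⊎ (Data.Nat._≤_ (deg G E' (proj₂ (ends G e))) (c (proj₂ (ends G e))))
lemma4 G c ε ε>0 E' maximal e e∈E'
  with deg G E' (proj₁ (ends G e)) ≤? c (proj₁ (ends G e))
     | deg G E' (proj₂ (ends G e)) ≤? c (proj₂ (ends G e))
... | yes u-ok | _       = inj₁ u-ok
... | no _     | yes v-ok = inj₂ v-ok
... | no u-over | no v-over = ⊥-elim (no-descent ε (phi G c ε (toggle E' e)) ε>0 improves)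
  where
  improves : phi G c ε (toggle E' e) ℚ.≤ phi G c ε (toggle E' e) - (ε + ε)
  improves = subst (phi G c ε (toggle E' e) ℚ.≤_)
    (phi-after-deletion G c ε E' e e∈E' u-over v-over) (maximal e)
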